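{- Let $k$ be a non-negative integer and let $G\in\Delta_k$. Then for every vertex $v$ of $G$, the graph $G\setminus v$ has linear rank-width at most $k$.
   Context: Graphs are finite and simple. $G\setminus v$ is $G$ with $v$ deleted. For $X\subseteq V(G)$, $\mathrm{cutrk}_G(X)$ is the binary rank of the submatrix of the adjacency matrix with rows $X$ and columns $V(G)\setminus X$. A linear layout is an ordering $(v_1,\dots,v_n)$ of $V(G)$ with width $\max_i\mathrm{cutrk}_G(\{v_1,\dots,v_i\})$ (or $0$ if $n\le1$). The linear rank-width is the minimum width of a linear layout. A delta composition of $G_1,G_2,G_3$ is obtained from their disjoint union by choosing $v_i\in V(G_i)$ and adding the triangle $v_1v_2v_3$. $\Delta_0=\{K_2\}$, and for $i\ge1$, $\Delta_i$ is the set of delta compositions of three (not necessarily distinct) graphs in $\Delta_{i-1}$, up to isomorphism. -}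

module Defs where

open import Data.Nat using (ℕ; zero; suc; _+_; _≤_; _≤ᵇ_)
open import Data.Bool using (Bool; true; false; not; _∧_; _xor_)
open import Data.Bool.Properties using (∧-comm)
open import Data.Fin using (Fin; zero; suc; toℕ; splitAt; punchIn; _≟_)
open import Data.Fin.Properties using (punchIn-injective)
open import Data.Fin.Subset using (Subset; _∈_; _∉_; _⊆_; ∣_∣)
open import Data.Fin.Permutation using (Permutation; Permutation′; _⟨$⟩ʳ_; _⟨$⟩ˡ_)
open import Data.Vec using (tabulate)
open import Data.Sum using (_⊎_; inj₁; inj₂)
open import Data.Product using (Σ; ∃; _,_)
open import Relation.Nullary.Decidable using (⌊_⌋; yes; no)
open import Relation.Binary.PropositionalEquality using (_≡_; refl)

record Graph (n : ℕ) : Set where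
  field
    adj    : Fin n → Fin n → Bool
    adj-sym : ∀ x y → adj x y ≡ adj y x
    adj-irrefl : ∀ x → adj x x ≡ false
open Graph public

_≅_ : ∀ {n m} → Graph n → Graph m → Set
_≅_ {n} {m} G H =
  Σ (Permutation n m) λ π → ∀ x y → adj G x y ≡ adj H (π ⟨$⟩ʳ x) (π ⟨$⟩ʳ y)

K2 : Graph 2
K2 = record { adj = λ x y → not ⌊ x ≟ y ⌋ ; adj-sym = s ; adj-irrefl = i }
  where
  s : ∀ x y → not ⌊ x ≟ y ⌋ ≡ not ⌊ y ≟ x ⌋
  s zero zero = refl
  s zero (suc zero) = refl
  s (suc zero) zero = refl
  s (suc zero) (suc zero) = refl
  i : ∀ x → not ⌊ x ≟ x ⌋ ≡ false
  i zero = refl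
  i (suc zero) = refl

_∖_ : ∀ {n} → Graph (suc n) → Fin (suc n) → Graph n
G ∖ v = record
  { adj = λ x y → adj G (punchIn v x) (punchIn v y)
  ; adj-sym = λ x y → adj-sym G (punchIn v x) (punchIn v y)
  ; adj-irrefl = λ x → adj-irrefl G (punchIn v x) }

module _ {a b c : ℕ} (G₁ : Graph a) (G₂ : Graph b) (G₃ : Graph c)
         (v₁ : Fin a) (v₂ : Fin b) (v₃ : Fin c) where

  Part : Set
  Part = Fin a ⊎ (Fin b ⊎ Fin c)

  part : Fin (a + (b + c)) → Part
  part x with splitAt a x
  ... | inj₁ y = inj₁ y
  ... | inj₂ z with splitAt b z
  ...   | inj₁ y = inj₂ (inj₁ y)
  ...   | inj₂ y = inj₂ (inj₂ y)

  isV : Part → Bool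
  isV (inj₁ x) = ⌊ x ≟ v₁ ⌋
  isV (inj₂ (inj₁ x)) = ⌊ x ≟ v₂ ⌋
  isV (inj₂ (inj₂ x)) = ⌊ x ≟ v₃ ⌋

  adjP : Part → Part → Bool
  adjP (inj₁ x) (inj₁ y) = adj G₁ x y
  adjP (inj₂ (inj₁ x)) (inj₂ (inj₁ y)) = adj G₂ x y
  adjP (inj₂ (inj₂ x)) (inj₂ (inj₂ y)) = adj G₃ x y
  adjP p@(inj₁ _) q@(inj₂ (inj₁ _)) = isV p ∧ isV q
  adjP p@(inj₁ _) q@(inj₂ (inj₂ _)) = isV p ∧ isV q
  adjP p@(inj₂ (inj₁ _)) q@(inj₁ _) = isV p ∧ isV q
  adjP p@(inj₂ (inj₂ _)) q@(inj₁ _) = isV p ∧ isV q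
  adjP p@(inj₂ (inj₁ _)) q@(inj₂ (inj₂ _)) = isV p ∧ isV q
  adjP p@(inj₂ (inj₂ _)) q@(inj₂ (inj₁ _)) = isV p ∧ isV q

  adjP-sym : ∀ p q → adjP p q ≡ adjP q p
  adjP-sym (inj₁ x) (inj₁ y) = adj-sym G₁ x y
  adjP-sym (inj₂ (inj₁ x)) (inj₂ (inj₁ y)) = adj-sym G₂ x y
  adjP-sym (inj₂ (inj₂ x)) (inj₂ (inj₂ y)) = adj-sym G₃ x y
  adjP-sym p@(inj₁ _) q@(inj₂ (inj₁ _)) = ∧-comm (isV p) (isV q)
  adjP-sym p@(inj₁ _) q@(inj₂ (inj₂ _)) = ∧-comm (isV p) (isV q)
  adjP-sym p@(inj₂ (inj₁ _)) q@(inj₁ _) = ∧-comm (isV p) (isV q)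
  adjP-sym p@(inj₂ (inj₂ _)) q@(inj₁ _) = ∧-comm (isV p) (isV q)
  adjP-sym p@(inj₂ (inj₁ _)) q@(inj₂ (inj₂ _)) = ∧-comm (isV p) (isV q)
  adjP-sym p@(inj₂ (inj₂ _)) q@(inj₂ (inj₁ _)) = ∧-comm (isV p) (isV q)

  adjP-irrefl : ∀ p → adjP p p ≡ false
  adjP-irrefl (inj₁ x) = adj-irrefl G₁ x
  adjP-irrefl (inj₂ (inj₁ x)) = adj-irrefl G₂ x
  adjP-irrefl (inj₂ (inj₂ x)) = adj-irrefl G₃ x

  -- disjoint union of G₁, G₂, G₃ plus the triangle v₁v₂v₃
  deltaComp : Graph (a + (b + c))
  deltaComp = record
    { adj = λ x y → adjP (part x) (part y)
    ; adj-sym = λ x y → adjP-sym (part x) (part y)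
    ; adj-irrefl = λ x → adjP-irrefl (part x) }

data Δ : ℕ → ∀ {n} → Graph n → Set where
  base : ∀ {n} {G : Graph n} → G ≅ K2 → Δ 0 G
  comp : ∀ {k a b c} {G₁ : Graph a} {G₂ : Graph b} {G₃ : Graph c} →
         Δ k G₁ → Δ k G₂ → Δ k G₃ →
         (v₁ : Fin a) (v₂ : Fin b) (v₃ : Fin c) →
         ∀ {n} {G : Graph n} → G ≅ deltaComp G₁ G₂ G₃ v₁ v₂ v₃ → Δ (suc k) G

xorSum : ∀ {n} → (Fin n → Bool) → Bool
xorSum {zero} f = false
xorSum {suc n} f = f zero xor xorSum (λ i → f (suc i))

-- the GF(2)-sum of the rows indexed by T of the matrix A_G[X, V∖X] is zero
RowSumZero : ∀ {n} → Graph n → Subset n → Subset n → Set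
RowSumZero {n} G X T =
  ∀ (y : Fin n) → y ∉ X →
  xorSum (λ x → Data.Vec.lookup T x ∧ adj G x y) ≡ false
  where import Data.Vec

-- rows indexed by S (S ⊆ X) are linearly independent over GF(2)
LinIndep : ∀ {n} → Graph n → Subset n → Subset n → Set
LinIndep {n} G X S =
  ∀ (T : Subset n) → T ⊆ S → RowSumZero G X T → ∀ (x : Fin n) → x ∉ T

-- cutrk_G(X) ≤ r : every linearly independent set of rows of
-- A_G[X, V∖X] has at most r elements (rank = maximal number of
-- linearly independent rows)
CutRankAtMost : ∀ {n} → Graph n → Subset n → ℕ → Set
CutRankAtMost {n} G X r =
  ∀ (S : Subset n) → S ⊆ X → LinIndep G X S → ∣ S ∣ ≤ r

-- A linear layout is an ordering (v_0,…,v_{n-1}) given by a permutation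
-- σ with v_j = σ ⟨$⟩ʳ j.  prefix σ i = {v_0,…,v_i}.
prefix : ∀ {n} → Permutation′ n → Fin n → Subset n
prefix σ i = tabulate λ v → toℕ (σ ⟨$⟩ˡ v) ≤ᵇ toℕ i

WidthAtMost : ∀ {n} → Graph n → Permutation′ n → ℕ → Set
WidthAtMost G σ k = ∀ i → CutRankAtMost G (prefix σ i) k

LinRankWidthAtMost : ∀ {n} → Graph n → ℕ → Set
LinRankWidthAtMost {n} G k = Σ (Permutation′ n) λ σ → WidthAtMost G σ k

-- Let G be the delta composition of G₁, G₂, G₃ along the triangle v₁v₂v₃, and delete a
-- vertex v, say of G₂. By induction G₁ ∖ v₁, G₂ ∖ v and G₃ ∖ v₃ have linear layouts of width
-- k - 1, and G ∖ v is laid out as  G₁ ∖ v₁, v₁, G₂ ∖ v, v₃, G₃ ∖ v₃.  Adding one vertex to a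
-- layout raises every cut-rank by at most one. Between the three blocks only triangle edges
-- exist, so for a cut inside G₂ ∖ v the row of v₁ and the part of the rows of G₂ towards G₃
-- are both multiples of the indicator of the triangle: together they cost one extra dimension.
-- Cut-ranks are bounded by exhibiting r vectors spanning the rows of the cut matrix; by the
-- Steinitz exchange argument over GF(2), no more than r of these rows are then independent.

module Submission where

open import Defs
open import Algebra using (CommutativeRing)
open import Data.Bool using (Bool; true; false; not; _∧_; _xor_; if_then_else_)
open import Data.Bool.Properties
  using (∧-assoc; ∧-comm; ∧-zeroʳ; ∧-identityʳ; ∧-distribˡ-xor; ∧-distribʳ-xor;
         xor-identityʳ; xor-same; xor-∧-commutativeRing; T-≡)
import Data.Bool.Properties as Bool
open import Data.Empty using (⊥-elim)
open import Data.Fin using (Fin; zero; suc; _≟_; toℕ; fromℕ<; punchOut; punchIn; splitAt; join)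
open import Data.Fin.Properties
  using (any?; toℕ-fromℕ<; punchOut-injective; injective⇒≤; punchInᵢ≢i; punchIn-injective;
         join-splitAt)
open import Data.Fin.Permutation
  using (Permutation; Permutation′; permutation; _⟨$⟩ʳ_; _⟨$⟩ˡ_; inverseˡ)
open import Data.Fin.Subset
  using (Subset; inside; outside; _∈_; _∉_; _-_; ∣_∣; Nonempty)
open import Data.Fin.Subset.Properties
  using (_∈?_; drop-there; p─q⊆p; p─⊥≡p; nonempty?; Empty-unique; ∣⊥∣≡0;
         p⊆q⇒∣p∣≤∣q∣; p⊂q⇒∣p∣<∣q∣; ∣⊤∣≡n; ∈⊤)
open import Data.Nat
  using (ℕ; zero; suc; _+_; _⊔_; _≤_; _<_; _≤?_; _<?_; _<ᵇ_; z≤n; z<s; s<s; s≤s⁻¹; s<s⁻¹)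
open import Data.Nat.Properties
  using (≤-refl; ≤-reflexive; ≤-antisym; ≤-trans; <-trans; <-≤-trans; <-irrefl; <⇒≤; <⇒≢;
         <⇒≱; ≰⇒>; ≮⇒≥; 1+n≰n; 1+n≢0; n<1+n; suc-injective; m≤m+n; m≤m⊔n; m≤n⊔m;
         +-monoʳ-<; +-cancelˡ-≤; +-cancelˡ-<; +-cancelˡ-≡; m≤n⇒∃[o]m+o≡n;
         ≤ᵇ⇒≤; ≤⇒≤ᵇ; <ᵇ⇒<; <⇒<ᵇ)
open import Data.Product using (∃; _×_; _,_; proj₁; proj₂; map₂)
open import Data.Sum using (_⊎_; inj₁; inj₂)
open import Data.Unit using (⊤; tt)
import Data.Vec as Vec
open import Data.Vec using (here; there; tabulate)
open import Data.Vec.Properties using (lookup∘tabulate; []=⇒lookup; lookup⇒[]=)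
open import Data.Vec.Functional using (_∷_)
open import Function using (_∘_; id; case_of_)
open import Function.Bundles using (Equivalence)
open import Function.Definitions using (Injective)
open import Relation.Binary.PropositionalEquality
open import Relation.Nullary using (Dec; yes; no; ¬_; contradiction)
open import Relation.Nullary.Decidable using (⌊_⌋; isYes≗does; ⌊⌋-map′; dec-true; dec-false; _×-dec_)
open import Algebra.Properties.CommutativeSemigroup
  (CommutativeRing.+-commutativeSemigroup xor-∧-commutativeRing) using (interchange)

xorSum-cong : ∀ {n} {f g : Fin n → Bool} → f ≗ g → xorSum f ≡ xorSum g
xorSum-cong {zero}  f≗g = refl
xorSum-cong {suc n} f≗g = cong₂ _xor_ (f≗g zero) (xorSum-cong (f≗g ∘ suc))

xorSum-false : ∀ n → xorSum {n} (λ _ → false) ≡ false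
xorSum-false zero    = refl
xorSum-false (suc n) = xorSum-false n

xor-xorSum-false : ∀ {r} b → b xor xorSum {r} (λ _ → false) ≡ b
xor-xorSum-false {r} b = trans (cong (b xor_) (xorSum-false r)) (xor-identityʳ b)

xorSum-xor : ∀ {n} (f g : Fin n → Bool) →
             xorSum (λ i → f i xor g i) ≡ xorSum f xor xorSum g
xorSum-xor {zero}  f g = refl
xorSum-xor {suc n} f g =
  trans (cong ((f zero xor g zero) xor_) (xorSum-xor (f ∘ suc) (g ∘ suc)))
        (interchange (f zero) (g zero) _ _)

xorSum-∧ˡ : ∀ {n} a (f : Fin n → Bool) → xorSum (λ i → a ∧ f i) ≡ a ∧ xorSum f
xorSum-∧ˡ {zero}  a f = sym (∧-zeroʳ a)
xorSum-∧ˡ {suc n} a f =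
  trans (cong ((a ∧ f zero) xor_) (xorSum-∧ˡ a (f ∘ suc))) (sym (∧-distribˡ-xor a _ _))

xorSum-∧ʳ : ∀ {n} a (f : Fin n → Bool) → xorSum (λ i → f i ∧ a) ≡ xorSum f ∧ a
xorSum-∧ʳ a f = trans (xorSum-cong (λ i → ∧-comm (f i) a))
                      (trans (xorSum-∧ˡ a f) (∧-comm a (xorSum f)))

⌊≟⌋-refl : ∀ {n} (x : Fin n) → ⌊ x ≟ x ⌋ ≡ true
⌊≟⌋-refl x = trans (isYes≗does (x ≟ x)) (dec-true (x ≟ x) refl)

⌊≟⌋-≢ : ∀ {n} {x y : Fin n} → x ≢ y → ⌊ x ≟ y ⌋ ≡ false
⌊≟⌋-≢ {x = x} {y} x≢y = trans (isYes≗does (x ≟ y)) (dec-false (x ≟ y) x≢y)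

≟⇒≡ : ∀ {n} {x y : Fin n} → ⌊ x ≟ y ⌋ ≡ true → x ≡ y
≟⇒≡ {x = x} {y} eq with x ≟ y | eq
... | yes x≡y | _ = x≡y
... | no  _   | ()

distinct-not-both : ∀ {n} {x y v : Fin n} → x ≢ y → ⌊ x ≟ v ⌋ ∧ ⌊ y ≟ v ⌋ ≡ false
distinct-not-both {x = x} {y} {v} x≢y = case x ≟ v of λ where
  (yes refl) → trans (cong (_∧ ⌊ y ≟ x ⌋) (⌊≟⌋-refl x)) (⌊≟⌋-≢ (x≢y ∘ sym))
  (no  x≢v)  → cong (_∧ ⌊ y ≟ v ⌋) (⌊≟⌋-≢ x≢v)

xorSum-point : ∀ {n} (i₀ : Fin n) (f : Fin n → Bool) →
               xorSum (λ i → ⌊ i ≟ i₀ ⌋ ∧ f i) ≡ f i₀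
xorSum-point {suc n} zero     f = trans (cong (f zero xor_) (xorSum-false n)) (xor-identityʳ _)
xorSum-point {suc n} (suc i₀) f =
  trans (xorSum-cong (λ i → cong (_∧ f (suc i)) (⌊⌋-map′ _ _ (i ≟ i₀)))) (xorSum-point i₀ (f ∘ suc))

module _ {C : Set} where

  combination : ∀ {r} → (Fin r → Bool) → (Fin r → C → Bool) → C → Bool
  combination c w y = xorSum λ j → c j ∧ w j y

  combination-xorˡ : ∀ {r} (c d : Fin r → Bool) (w : Fin r → C → Bool) y →
    combination (λ j → c j xor d j) w y ≡ combination c w y xor combination d w y
  combination-xorˡ c d w y =
    trans (xorSum-cong (λ j → ∧-distribʳ-xor (w j y) (c j) (d j)))
          (xorSum-xor (λ j → c j ∧ w j y) (λ j → d j ∧ w j y))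

  combination-xorʳ : ∀ {r} (c : Fin r → Bool) (v w : Fin r → C → Bool) y →
    combination c (λ j z → v j z xor w j z) y ≡ combination c v y xor combination c w y
  combination-xorʳ c v w y =
    trans (xorSum-cong (λ j → ∧-distribˡ-xor (c j) (v j y) (w j y)))
          (xorSum-xor (λ j → c j ∧ v j y) (λ j → c j ∧ w j y))

  combination-scaleˡ : ∀ {r} a (c : Fin r → Bool) (w : Fin r → C → Bool) y →
    combination (λ j → a ∧ c j) w y ≡ a ∧ combination c w y
  combination-scaleˡ a c w y =
    trans (xorSum-cong (λ j → ∧-assoc a (c j) (w j y))) (xorSum-∧ˡ a (λ j → c j ∧ w j y))

  combination-scaleʳ : ∀ {r} (c a : Fin r → Bool) (v : C → Bool) y →
    combination c (λ j z → a j ∧ v z) y ≡ xorSum (λ j → c j ∧ a j) ∧ v y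
  combination-scaleʳ c a v y =
    trans (xorSum-cong (λ j → sym (∧-assoc (c j) (a j) (v y)))) (xorSum-∧ʳ (v y) (λ j → c j ∧ a j))

  combination-point : ∀ {r} (j₀ : Fin r) (w : Fin r → C → Bool) y →
    combination (λ j → ⌊ j ≟ j₀ ⌋) w y ≡ w j₀ y
  combination-point j₀ w y = xorSum-point j₀ (λ j → w j y)

  combination-zeroʳ : ∀ {r} (c : Fin r → Bool) (w : Fin r → C → Bool) y →
                      (∀ j → w j y ≡ false) → combination c w y ≡ false
  combination-zeroʳ {r} c w y w≡0 =
    trans (xorSum-cong (λ j → trans (cong (c j ∧_) (w≡0 j)) (∧-zeroʳ (c j)))) (xorSum-false r)

  combination-congʳ : ∀ {r} (c : Fin r → Bool) {w w′ : Fin r → C → Bool} {y} →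
                      (∀ j → w j y ≡ w′ j y) → combination c w y ≡ combination c w′ y
  combination-congʳ c w≡w′ = xorSum-cong (λ j → cong (c j ∧_) (w≡w′ j))

x∉p-x : ∀ {n} (x : Fin n) (p : Subset n) → x ∉ p - x
x∉p-x zero    (s Vec.∷ p) ()
x∉p-x (suc x) (s Vec.∷ p) = x∉p-x x p ∘ drop-there

∣p∣≡1+∣p-x∣ : ∀ {n} {x : Fin n} {p : Subset n} → x ∈ p → ∣ p ∣ ≡ suc ∣ p - x ∣
∣p∣≡1+∣p-x∣ {p = inside Vec.∷ p} here = cong (suc ∘ ∣_∣) (sym (p─⊥≡p p))
∣p∣≡1+∣p-x∣ {p = inside  Vec.∷ p} (there x∈p) = cong suc (∣p∣≡1+∣p-x∣ x∈p)
∣p∣≡1+∣p-x∣ {p = outside Vec.∷ p} (there x∈p) = ∣p∣≡1+∣p-x∣ x∈p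

0<∣p∣⇒nonempty : ∀ {n} {p : Subset n} → 0 < ∣ p ∣ → Nonempty p
0<∣p∣⇒nonempty {n} {p} 0<∣p∣ with nonempty? p
... | yes p≠∅ = p≠∅
... | no  p=∅ = contradiction (trans (cong ∣_∣ (Empty-unique p=∅)) (∣⊥∣≡0 n)) (<⇒≢ 0<∣p∣ ∘ sym)

Dependent : ∀ {C : Set} {n} → (Fin n → C → Bool) → Subset n → Set
Dependent {n = n} u S =
  ∃ λ (T : Fin n → Bool) → (∀ {x} → T x ≡ true → x ∈ S) × (∃ λ x → T x ≡ true) ×
                            (∀ y → combination T u y ≡ false)

-- Row operations clearing the coefficient of the first spanning vector with the pivot row x₀.
module Elimination {C : Set} {n r} (u : Fin n → C → Bool) (w : Fin (suc r) → C → Bool)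
  (coeff : Fin n → Fin (suc r) → Bool) (x₀ : Fin n) where

  u′ : Fin n → C → Bool
  u′ x y = u x y xor (coeff x zero ∧ u x₀ y)

  coeff′ : Fin n → Fin r → Bool
  coeff′ x j = coeff x (suc j) xor (coeff x zero ∧ coeff x₀ (suc j))

  u′-spanned : coeff x₀ zero ≡ true → ∀ x y →
    u x y ≡ combination (coeff x) w y → u x₀ y ≡ combination (coeff x₀) w y →
    u′ x y ≡ combination (coeff′ x) (w ∘ suc) y
  u′-spanned pivot x y ux ux₀ = begin
      u x y xor (c ∧ u x₀ y)
        ≡⟨ cong₂ (λ p q → p xor (c ∧ q)) ux ux₀ ⟩
      combination (coeff x) w y xor (c ∧ combination (coeff x₀) w y)
        ≡⟨ cong (combination (coeff x) w y xor_) (sym (combination-scaleˡ c (coeff x₀) w y)) ⟩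
      combination (coeff x) w y xor combination (λ j → c ∧ coeff x₀ j) w y
        ≡⟨ sym (combination-xorˡ (coeff x) (λ j → c ∧ coeff x₀ j) w y) ⟩
      ((c xor (c ∧ coeff x₀ zero)) ∧ w zero y) xor combination (coeff′ x) (w ∘ suc) y
        ≡⟨ cong (λ b → (b ∧ w zero y) xor combination (coeff′ x) (w ∘ suc) y) pivot-cancels ⟩
      combination (coeff′ x) (w ∘ suc) y ∎
      where
      open ≡-Reasoning
      c = coeff x zero
      pivot-cancels : c xor (c ∧ coeff x₀ zero) ≡ false
      pivot-cancels = trans (cong (λ b → c xor (c ∧ b)) pivot)
                            (trans (cong (c xor_) (∧-identityʳ c)) (xor-same c))

  dependent-lift : ∀ {S} → x₀ ∈ S → Dependent u′ (S - x₀) → Dependent u S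
  dependent-lift {S} x₀∈S (T′ , T′⊆S′ , (x₁ , T′x₁) , T′-dependent) =
    T , T⊆S , (x₁ , Tx₁) , T-dependent
    where
    b : Bool
    b = xorSum λ x → T′ x ∧ coeff x zero
    T : Fin n → Bool
    T x = T′ x xor (b ∧ ⌊ x ≟ x₀ ⌋)
    T≡T′ : ∀ {x} → x ≢ x₀ → T x ≡ T′ x
    T≡T′ {x} x≢x₀ = trans (cong (λ z → T′ x xor (b ∧ z)) (⌊≟⌋-≢ x≢x₀))
                          (trans (cong (T′ x xor_) (∧-zeroʳ b)) (xor-identityʳ (T′ x)))
    T⊆S : ∀ {x} → T x ≡ true → x ∈ S
    T⊆S {x} Tx = case x ≟ x₀ of λ where
      (yes refl)  → x₀∈S
      (no  x≢x₀) → p─q⊆p S _ (T′⊆S′ (trans (sym (T≡T′ x≢x₀)) Tx))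
    Tx₁ : T x₁ ≡ true
    Tx₁ = trans (T≡T′ (λ { refl → x∉p-x x₀ S (T′⊆S′ T′x₁) })) T′x₁
    T-dependent : ∀ y → combination T u y ≡ false
    T-dependent y = begin
      combination T u y
        ≡⟨ combination-xorˡ T′ (λ x → b ∧ ⌊ x ≟ x₀ ⌋) u y ⟩
      combination T′ u y xor combination (λ x → b ∧ ⌊ x ≟ x₀ ⌋) u y
        ≡⟨ cong (combination T′ u y xor_)
             (trans (combination-scaleˡ b _ u y) (cong (b ∧_) (combination-point x₀ u y))) ⟩
      combination T′ u y xor (b ∧ u x₀ y)
        ≡⟨ sym (trans (combination-xorʳ T′ u (λ x z → coeff x zero ∧ u x₀ z) y)
                      (cong (combination T′ u y xor_)
                            (combination-scaleʳ T′ (λ x → coeff x zero) (u x₀) y))) ⟩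
      combination T′ u′ y
        ≡⟨ T′-dependent y ⟩
      false ∎
      where open ≡-Reasoning

spanned⇒dependent : ∀ {C : Set} {n} r (u : Fin n → C → Bool) (w : Fin r → C → Bool)
  (coeff : Fin n → Fin r → Bool) {S : Subset n} →
  (∀ {x} → x ∈ S → ∀ y → u x y ≡ combination (coeff x) w y) →
  r < ∣ S ∣ → Dependent u S
spanned⇒dependent zero u w coeff {S} spans 0<∣S∣ with x₀ , x₀∈S ← 0<∣p∣⇒nonempty 0<∣S∣ =
  (λ x → ⌊ x ≟ x₀ ⌋) , (λ eq → subst (_∈ S) (sym (≟⇒≡ eq)) x₀∈S) , (x₀ , ⌊≟⌋-refl x₀) ,
  λ y → trans (combination-point x₀ u y) (spans x₀∈S y)
spanned⇒dependent (suc r) u w coeff {S} spans 1+r<∣S∣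
  with any? (λ x → x ∈? S ×-dec coeff x zero Bool.≟ true)
... | no noPivot =
  spanned⇒dependent r u (w ∘ suc) (λ x → coeff x ∘ suc) spans′ (<⇒≤ 1+r<∣S∣)
  where
  spans′ : ∀ {x} → x ∈ S → ∀ y → u x y ≡ combination (coeff x ∘ suc) (w ∘ suc) y
  spans′ {x} x∈S y = trans (spans x∈S y)
    (cong (λ b → (b ∧ w zero y) xor combination (coeff x ∘ suc) (w ∘ suc) y)
          (Bool.¬-not (λ pivot → noPivot (x , x∈S , pivot))))
... | yes (x₀ , x₀∈S , pivot) =
  dependent-lift x₀∈S (spanned⇒dependent r u′ (w ∘ suc) coeff′
    (λ x∈S′ y → u′-spanned pivot _ y (spans (p─q⊆p S _ x∈S′) y) (spans x₀∈S y))
    (s≤s⁻¹ (subst (suc r <_) (∣p∣≡1+∣p-x∣ x₀∈S) 1+r<∣S∣)))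
  where open Elimination u w coeff x₀

record Spanned {V : Set} (A : V → V → Bool) (Row Col : V → Set) (r : ℕ) : Set where
  field
    basis : Fin r → V → Bool
    coeff : V → Fin r → Bool
    spans : ∀ {x y} → Row x → Col y → A x y ≡ combination (coeff x) basis y

Spanned-pullback : ∀ {V W : Set} {A : V → V → Bool} {A′ : W → W → Bool}
  {Row Col : V → Set} {Row′ Col′ : W → Set} {r} (h : W → V) →
  (∀ x y → A′ x y ≡ A (h x) (h y)) →
  (∀ {x} → Row′ x → Row (h x)) → (∀ {y} → Col′ y → Col (h y)) →
  Spanned A Row Col r → Spanned A′ Row′ Col′ r
Spanned-pullback h h-adj h-row h-col S = record
  { basis = λ j y → basis j (h y)
  ; coeff = coeff ∘ h
  ; spans = λ {x} {y} x-row y-col → trans (h-adj x y) (spans (h-row x-row) (h-col y-col))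
  }
  where open Spanned S

∈-tabulate⁺ : ∀ {n} {f : Fin n → Bool} {x} → f x ≡ true → x ∈ tabulate f
∈-tabulate⁺ {f = f} {x} fx = lookup⇒[]= x (tabulate f) (trans (lookup∘tabulate f x) fx)

∈-tabulate⁻ : ∀ {n} {f : Fin n → Bool} {x} → x ∈ tabulate f → f x ≡ true
∈-tabulate⁻ {f = f} {x} x∈ = trans (sym (lookup∘tabulate f x)) ([]=⇒lookup x∈)

spanned⇒cutRankAtMost : ∀ {n r} (H : Graph n) (X : Subset n) →
  Spanned (adj H) (_∈ X) (_∉ X) r → CutRankAtMost H X r
spanned⇒cutRankAtMost {n} {r} H X S R R⊆X R-independent with ∣ R ∣ ≤? r
... | yes ∣R∣≤r = ∣R∣≤r
... | no  ∣R∣≰r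
  with T , T⊆R , (x₁ , Tx₁) , T-dependent ←
       spanned⇒dependent r (λ x (y , _) → adj H x y) (λ j (y , _) → Spanned.basis S j y) (Spanned.coeff S)
         (λ x∈R (y , y∉X) → Spanned.spans S (R⊆X x∈R) y∉X) (≰⇒> ∣R∣≰r)
  = ⊥-elim (R-independent (tabulate T) (T⊆R ∘ ∈-tabulate⁻) T-rowSumZero x₁ (∈-tabulate⁺ Tx₁))
  where
  T-rowSumZero : RowSumZero H X (tabulate T)
  T-rowSumZero y y∉X = trans (xorSum-cong (λ x → cong (_∧ adj H x y) (lookup∘tabulate T x)))
                             (T-dependent (y , y∉X))

-- Positions in ℕ encode the order of the Alive vertices; a deleted vertex keeps a position but
-- is ignored, so that deletion needs no reindexing of Fin.
record Layout {V : Set} (A : V → V → Bool) (Alive : V → Set) (k : ℕ) : Set where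
  field
    pos            : V → ℕ
    bound          : ℕ
    pos<bound      : ∀ x → pos x < bound
    pos-injective  : ∀ {x y} → Alive x → Alive y → pos x ≡ pos y → x ≡ y
    prefix-spanned : ∀ t → Spanned A (λ x → Alive x × pos x ≤ t) (λ y → Alive y × t < pos y) k

open Layout

Layout-pullback : ∀ {V W : Set} {A : V → V → Bool} {A′ : W → W → Bool}
  {Alive : V → Set} {Alive′ : W → Set} {k} (h : W → V) →
  (∀ x y → A′ x y ≡ A (h x) (h y)) → (∀ {x} → Alive′ x → Alive (h x)) →
  Injective _≡_ _≡_ h → Layout A Alive k → Layout A′ Alive′ k
Layout-pullback h h-adj h-alive h-injective L = record
  { pos            = pos L ∘ h
  ; bound          = bound L
  ; pos<bound      = pos<bound L ∘ h
  ; pos-injective  = λ x-alive y-alive → h-injective ∘ pos-injective L (h-alive x-alive) (h-alive y-alive)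
  ; prefix-spanned = λ t → Spanned-pullback h h-adj
      (λ (x-alive , x≤t) → h-alive x-alive , x≤t) (λ (y-alive , t<y) → h-alive y-alive , t<y)
      (prefix-spanned L t)
  }

Layout-pullback-≢ : ∀ {V W : Set} {A : V → V → Bool} {A′ : W → W → Bool} {k} (h : W → V) →
  (∀ x y → A′ x y ≡ A (h x) (h y)) → Injective _≡_ _≡_ h →
  ∀ {v} → Layout A (_≢ h v) k → Layout A′ (_≢ v) k
Layout-pullback-≢ h h-adj h-injective = Layout-pullback h h-adj (λ x≢v → x≢v ∘ h-injective) h-injective

strictlyInverseʳ⇒injective : ∀ {A B : Set} {f : A → B} (g : B → A) → (∀ x → g (f x) ≡ x) →
                             Injective _≡_ _≡_ f
strictlyInverseʳ⇒injective g gf≡id {x} {y} fx≡fy =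
  trans (sym (gf≡id x)) (trans (cong g fx≡fy) (gf≡id y))

⟨$⟩ʳ-injective : ∀ {m n} (π : Permutation m n) → Injective _≡_ _≡_ (π ⟨$⟩ʳ_)
⟨$⟩ʳ-injective π = strictlyInverseʳ⇒injective (π ⟨$⟩ˡ_) (λ _ → inverseˡ π)

injective⇒surjective : ∀ {n} {f : Fin n → Fin n} → Injective _≡_ _≡_ f → ∀ i → ∃ λ x → f x ≡ i
injective⇒surjective {suc m} {f} f-injective i with any? (λ x → f x ≟ i)
... | yes hit = hit
... | no  miss = contradiction (injective⇒≤ g-injective) 1+n≰n
  where
  i≢f : ∀ x → i ≢ f x
  i≢f x i≡fx = miss (x , sym i≡fx)
  g : Fin (suc m) → Fin m
  g x = punchOut (i≢f x)
  g-injective : Injective _≡_ _≡_ g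
  g-injective {x} {y} = f-injective ∘ punchOut-injective (i≢f x) (i≢f y)

module Sorting {n} (key : Fin n → ℕ) (key-injective : Injective _≡_ _≡_ key) where

  below : Fin n → Subset n
  below v = tabulate λ u → key u <ᵇ key v

  ∈below⁺ : ∀ {u v} → key u < key v → u ∈ below v
  ∈below⁺ u<v = ∈-tabulate⁺ (Equivalence.to T-≡ (<⇒<ᵇ u<v))

  ∈below⁻ : ∀ {u v} → u ∈ below v → key u < key v
  ∈below⁻ u∈ = <ᵇ⇒< _ _ (Equivalence.from T-≡ (∈-tabulate⁻ u∈))

  v∉below : ∀ v → v ∉ below v
  v∉below v = <-irrefl refl ∘ ∈below⁻

  ∣below∣<n : ∀ v → ∣ below v ∣ < n
  ∣below∣<n v = subst (∣ below v ∣ <_) (∣⊤∣≡n n) (p⊂q⇒∣p∣<∣q∣ ((λ _ → ∈⊤) , v , ∈⊤ , v∉below v))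

  ∣below∣-mono : ∀ {v w} → key v ≤ key w → ∣ below v ∣ ≤ ∣ below w ∣
  ∣below∣-mono v≤w = p⊆q⇒∣p∣≤∣q∣ λ u∈ → ∈below⁺ (<-≤-trans (∈below⁻ u∈) v≤w)

  ∣below∣-strict : ∀ {v w} → key v < key w → ∣ below v ∣ < ∣ below w ∣
  ∣below∣-strict {v} v<w =
    p⊂q⇒∣p∣<∣q∣ ((λ u∈ → ∈below⁺ (<-trans (∈below⁻ u∈) v<w)) , v , ∈below⁺ v<w , v∉below v)

  rank : Fin n → Fin n
  rank v = fromℕ< (∣below∣<n v)

  rank-≤⁺ : ∀ {v w} → key v ≤ key w → toℕ (rank v) ≤ toℕ (rank w)
  rank-≤⁺ {v} {w} v≤w = subst₂ _≤_ (sym (toℕ-fromℕ< _)) (sym (toℕ-fromℕ< _)) (∣below∣-mono v≤w)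

  rank-≤⁻ : ∀ {v w} → toℕ (rank v) ≤ toℕ (rank w) → key v ≤ key w
  rank-≤⁻ {v} {w} rv≤rw with key v ≤? key w
  ... | yes v≤w = v≤w
  ... | no  v≰w = contradiction rv≤rw (<⇒≱ (subst₂ _<_ (sym (toℕ-fromℕ< _)) (sym (toℕ-fromℕ< _))
                                             (∣below∣-strict (≰⇒> v≰w))))

  rank-injective : Injective _≡_ _≡_ rank
  rank-injective rv≡rw = key-injective (≤-antisym (rank-≤⁻ (≤-reflexive (cong toℕ rv≡rw)))
                                                  (rank-≤⁻ (≤-reflexive (cong toℕ (sym rv≡rw)))))

  σ : Permutation′ n
  σ = permutation (λ i → proj₁ (rank-surjective i)) rank
    (λ v → rank-injective (proj₂ (rank-surjective (rank v)))) (λ i → proj₂ (rank-surjective i))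
    where rank-surjective = injective⇒surjective rank-injective

  toℕ-i≡rank : ∀ i → toℕ i ≡ toℕ (rank (σ ⟨$⟩ʳ i))
  toℕ-i≡rank i = cong toℕ (sym (inverseˡ σ))

  ∈prefix⁻ : ∀ {i v} → v ∈ prefix σ i → key v ≤ key (σ ⟨$⟩ʳ i)
  ∈prefix⁻ {i} v∈ =
    rank-≤⁻ (subst (_ ≤_) (toℕ-i≡rank i) (≤ᵇ⇒≤ _ _ (Equivalence.from T-≡ (∈-tabulate⁻ v∈))))

  ∈prefix⁺ : ∀ {i v} → key v ≤ key (σ ⟨$⟩ʳ i) → v ∈ prefix σ i
  ∈prefix⁺ {i} v≤ =
    ∈-tabulate⁺ (Equivalence.to T-≡ (≤⇒≤ᵇ (subst (_ ≤_) (sym (toℕ-i≡rank i)) (rank-≤⁺ v≤))))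

layout⇒linRankWidthAtMost : ∀ {n k} (H : Graph n) → Layout (adj H) (λ _ → ⊤) k →
                            LinRankWidthAtMost H k
layout⇒linRankWidthAtMost H L = σ , λ i →
  spanned⇒cutRankAtMost H (prefix σ i)
    (Spanned-pullback id (λ _ _ → refl) (λ v∈ → tt , ∈prefix⁻ v∈) (λ v∉ → tt , ≰⇒> (v∉ ∘ ∈prefix⁺))
      (prefix-spanned L (pos L (σ ⟨$⟩ʳ i))))
  where open Sorting (pos L) (pos-injective L tt tt)

shift : ∀ {V : Set} {A : V → V → Bool} {Alive : V → Set} {k} → Layout A Alive k → Layout A Alive k
shift L = record
  { pos            = suc ∘ pos L
  ; bound          = suc (bound L)
  ; pos<bound      = s<s ∘ pos<bound L
  ; pos-injective  = λ x-alive y-alive → pos-injective L x-alive y-alive ∘ suc-injective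
  ; prefix-spanned = λ where
      zero    → record { basis = λ _ _ → false ; coeff = λ _ _ → false ; spans = λ { (_ , ()) _ } }
      (suc t) → Spanned-pullback id (λ _ _ → refl) (map₂ s≤s⁻¹) (map₂ s<s⁻¹) (prefix-spanned L t)
  }

module _ {m k} {A : Fin m → Fin m → Bool} {v : Fin m}
         (L : Layout A (_≢ v) k) (p : ℕ) (p-fresh : ∀ {x} → x ≢ v → pos L x ≢ p) where

  private
    pos⁺ : Fin m → ℕ
    pos⁺ x = if ⌊ x ≟ v ⌋ then p else pos L x

    pos⁺-v : pos⁺ v ≡ p
    pos⁺-v = cong (λ b → if b then p else pos L v) (⌊≟⌋-refl v)

    pos⁺-≢ : ∀ {x} → x ≢ v → pos⁺ x ≡ pos L x
    pos⁺-≢ {x} x≢v = cong (λ b → if b then p else pos L x) (⌊≟⌋-≢ x≢v)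

    Row Col : ℕ → Fin m → Set
    Row t x = ⊤ × pos⁺ x ≤ t
    Col t y = ⊤ × t < pos⁺ y

    pos⁺<bound : ∀ x → pos⁺ x < suc p ⊔ bound L
    pos⁺<bound x = case x ≟ v of λ where
      (yes refl) → <-≤-trans (subst (_< suc p) (sym pos⁺-v) (n<1+n p)) (m≤m⊔n (suc p) (bound L))
      (no  x≢v)  → <-≤-trans (subst (_< bound L) (sym (pos⁺-≢ x≢v)) (pos<bound L x))
                             (m≤n⊔m (suc p) (bound L))

    pos⁺-injective : ∀ {x y} → pos⁺ x ≡ pos⁺ y → x ≡ y
    pos⁺-injective {x} {y} eq = case ((x ≟ v) , (y ≟ v)) of λ where
      (yes refl , yes refl) → refl
      (yes refl , no  y≢v)  →
        contradiction (trans (sym (pos⁺-≢ y≢v)) (trans (sym eq) pos⁺-v)) (p-fresh y≢v)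
      (no  x≢v  , yes refl) →
        contradiction (trans (sym (pos⁺-≢ x≢v)) (trans eq pos⁺-v)) (p-fresh x≢v)
      (no  x≢v  , no  y≢v)  →
        pos-injective L x≢v y≢v (trans (sym (pos⁺-≢ x≢v)) (trans eq (pos⁺-≢ y≢v)))

    Row⇒≢ : ∀ {t x} → t < p → Row t x → x ≢ v
    Row⇒≢ t<p (_ , x≤t) refl = <⇒≱ t<p (subst (_≤ _) pos⁺-v x≤t)

    Col⇒≢ : ∀ {t y} → p ≤ t → Col t y → y ≢ v
    Col⇒≢ p≤t (_ , t<y) refl = <⇒≱ t<y (subst (_≤ _) (sym pos⁺-v) p≤t)

    L-row : ∀ {t x} → x ≢ v → Row t x → (x ≢ v) × pos L x ≤ t
    L-row x≢v (_ , x≤t) = x≢v , subst (_≤ _) (pos⁺-≢ x≢v) x≤t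

    L-col : ∀ {t y} → y ≢ v → Col t y → (y ≢ v) × t < pos L y
    L-col y≢v (_ , t<y) = y≢v , subst (_ <_) (pos⁺-≢ y≢v) t<y

    spanned-v-after : ∀ {t} → t < p → Spanned A (Row t) (Col t) (suc k)
    spanned-v-after {t} t<p = record
      { basis = (λ y → ⌊ y ≟ v ⌋) ∷ masked ; coeff = λ x → A x v ∷ coeff x ; spans = spans⁺ }
      where
      open Spanned (prefix-spanned L t)
      masked : Fin k → Fin m → Bool
      masked j y = basis j y ∧ not ⌊ y ≟ v ⌋
      spans⁺ : ∀ {x y} → Row t x → Col t y →
               A x y ≡ (A x v ∧ ⌊ y ≟ v ⌋) xor combination (coeff x) masked y
      spans⁺ {x} {y} x-row y-col with x≢v ← Row⇒≢ t<p x-row = case y ≟ v of λ where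
        (yes refl) → sym (trans
          (cong₂ _xor_ (cong (A x v ∧_) (⌊≟⌋-refl v))
                       (combination-zeroʳ (coeff x) masked v λ j →
                          trans (cong (λ b → basis j v ∧ not b) (⌊≟⌋-refl v)) (∧-zeroʳ _)))
          (trans (xor-identityʳ _) (∧-identityʳ (A x v))))
        (no y≢v) → trans (spans (L-row x≢v x-row) (L-col y≢v y-col)) (sym (cong₂ _xor_
          (trans (cong (A x v ∧_) (⌊≟⌋-≢ y≢v)) (∧-zeroʳ (A x v)))
          (combination-congʳ (coeff x) {masked} {basis} λ j →
             trans (cong (λ b → basis j y ∧ not b) (⌊≟⌋-≢ y≢v)) (∧-identityʳ _))))

    spanned-v-within : ∀ {t} → p ≤ t → Spanned A (Row t) (Col t) (suc k)
    spanned-v-within {t} p≤t = record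
      { basis = A v ∷ basis ; coeff = λ x → coeff⁺ x (x ≟ v) ; spans = spans⁺ }
      where
      open Spanned (prefix-spanned L t)
      coeff⁺ : ∀ x → Dec (x ≡ v) → Fin (suc k) → Bool
      coeff⁺ x (yes _) = true ∷ λ _ → false
      coeff⁺ x (no _)  = false ∷ coeff x
      spans⁺ : ∀ {x y} → Row t x → Col t y → A x y ≡ combination (coeff⁺ x (x ≟ v)) (A v ∷ basis) y
      spans⁺ {x} {y} x-row y-col = spans-by (x ≟ v) x-row y-col
        where
        spans-by : (x≟v : Dec (x ≡ v)) → Row t x → Col t y →
                   A x y ≡ combination (coeff⁺ x x≟v) (A v ∷ basis) y
        spans-by (yes refl) _     _     = sym (xor-xorSum-false {k} (A v y))
        spans-by (no  x≢v)  x-row y-col =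
          spans (L-row x≢v x-row) (L-col (Col⇒≢ p≤t y-col) y-col)

  insertVertex : Layout A (λ _ → ⊤) (suc k)
  insertVertex = record
    { pos            = pos⁺
    ; bound          = suc p ⊔ bound L
    ; pos<bound      = pos⁺<bound
    ; pos-injective  = λ _ _ → pos⁺-injective
    ; prefix-spanned = λ t → case t <? p of λ where
        (yes t<p) → spanned-v-after t<p
        (no  t≮p) → spanned-v-within (≮⇒≥ t≮p)
    }

  insertVertex-pos-v : pos insertVertex v ≡ p
  insertVertex-pos-v = pos⁺-v

  insertVertex-pos-≢ : ∀ {x} → x ≢ v → pos insertVertex x ≡ pos L x
  insertVertex-pos-≢ = pos⁺-≢

module _ {m k} {A : Fin m → Fin m → Bool} {v : Fin m} (L : Layout A (_≢ v) k) where

  private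
    bound-fresh : ∀ {x} → x ≢ v → pos L x ≢ bound L
    bound-fresh {x} _ = <⇒≢ (pos<bound L x)

  appendVertex : Layout A (λ _ → ⊤) (suc k)
  appendVertex = insertVertex L (bound L) bound-fresh

  appendVertex-last : ∀ x → pos appendVertex x ≤ pos appendVertex v
  appendVertex-last x = case x ≟ v of λ where
    (yes refl) → ≤-refl
    (no  x≢v)  → subst₂ _≤_ (sym (insertVertex-pos-≢ L _ bound-fresh x≢v))
                            (sym (insertVertex-pos-v L _ bound-fresh)) (<⇒≤ (pos<bound L x))

  prependVertex : Layout A (λ _ → ⊤) (suc k)
  prependVertex = insertVertex (shift L) 0 (λ _ → 1+n≢0)

  prependVertex-first : pos prependVertex v ≡ 0
  prependVertex-first = insertVertex-pos-v (shift L) 0 (λ _ → 1+n≢0)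

≢-unique-in-Fin2 : ∀ {u x y : Fin 2} → x ≢ u → y ≢ u → x ≡ y
≢-unique-in-Fin2 {_}        {zero}     {zero}     _   _   = refl
≢-unique-in-Fin2 {_}        {suc zero} {suc zero} _   _   = refl
≢-unique-in-Fin2 {zero}     {zero}     {suc zero} x≢u _   = contradiction refl x≢u
≢-unique-in-Fin2 {suc zero} {zero}     {suc zero} _   y≢u = contradiction refl y≢u
≢-unique-in-Fin2 {zero}     {suc zero} {zero}     _   y≢u = contradiction refl y≢u
≢-unique-in-Fin2 {suc zero} {suc zero} {zero}     x≢u _   = contradiction refl x≢u

K2-layout : ∀ u → Layout (adj K2) (_≢ u) 0
K2-layout u = record
  { pos            = λ _ → 0
  ; bound          = 1
  ; pos<bound      = λ _ → z<s
  ; pos-injective  = λ x≢u y≢u _ → ≢-unique-in-Fin2 x≢u y≢u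
  ; prefix-spanned = λ _ → record { basis = λ () ; coeff = λ _ () ; spans = λ { _ (_ , ()) } }
  }

pattern ι₁ x = inj₁ x
pattern ι₂ x = inj₂ (inj₁ x)
pattern ι₃ x = inj₂ (inj₂ x)

module DeltaLayout {a b c k} {G₁ : Graph a} {G₂ : Graph b} {G₃ : Graph c}
  {v₁ : Fin a} {v₂ : Fin b} {v₃ : Fin c} {u : Fin b}
  (L₁ : Layout (adj G₁) (λ _ → ⊤) (suc k)) (v₁-last : ∀ x → pos L₁ x ≤ pos L₁ v₁)
  (L₂ : Layout (adj G₂) (_≢ u) k)
  (L₃ : Layout (adj G₃) (λ _ → ⊤) (suc k)) (v₃-first : pos L₃ v₃ ≡ 0) where

  V : Set
  V = Part G₁ G₂ G₃ v₁ v₂ v₃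

  A : V → V → Bool
  A = adjP G₁ G₂ G₃ v₁ v₂ v₃

  triangle : V → Bool
  triangle = isV G₁ G₂ G₃ v₁ v₂ v₃

  Alive : V → Set
  Alive z = z ≢ ι₂ u

  m₁ m₂ : ℕ
  m₁ = bound L₁
  m₂ = m₁ + bound L₂

  position : V → ℕ
  position (ι₁ x) = pos L₁ x
  position (ι₂ x) = m₁ + pos L₂ x
  position (ι₃ x) = m₂ + pos L₃ x

  Row Col : ℕ → V → Set
  Row t z = Alive z × position z ≤ t
  Col t z = Alive z × t < position z

  ι₁<m₁ : ∀ x → position (ι₁ x) < m₁
  ι₁<m₁ = pos<bound L₁

  m₁≤ι₂ : ∀ x → m₁ ≤ position (ι₂ x)
  m₁≤ι₂ x = m≤m+n m₁ (pos L₂ x)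

  ι₂<m₂ : ∀ x → position (ι₂ x) < m₂
  ι₂<m₂ x = +-monoʳ-< m₁ (pos<bound L₂ x)

  m₂≤ι₃ : ∀ x → m₂ ≤ position (ι₃ x)
  m₂≤ι₃ x = m≤m+n m₂ (pos L₃ x)

  m₁≤m₂ : m₁ ≤ m₂
  m₁≤m₂ = m≤m+n m₁ (bound L₂)

  m₁≤ι₃ : ∀ x → m₁ ≤ position (ι₃ x)
  m₁≤ι₃ x = ≤-trans m₁≤m₂ (m₂≤ι₃ x)

  ∉Row : ∀ {t z} → t < position z → ¬ Row t z
  ∉Row t<z (_ , z≤t) = <⇒≱ t<z z≤t

  ∉Col : ∀ {t z} → position z ≤ t → ¬ Col t z
  ∉Col z≤t (_ , t<z) = <⇒≱ t<z z≤t

  ι₁<ι₂ : ∀ x y → position (ι₁ x) < position (ι₂ y)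
  ι₁<ι₂ x y = <-≤-trans (ι₁<m₁ x) (m₁≤ι₂ y)

  ι₁<ι₃ : ∀ x y → position (ι₁ x) < position (ι₃ y)
  ι₁<ι₃ x y = <-≤-trans (ι₁<m₁ x) (m₁≤ι₃ y)

  ι₂<ι₃ : ∀ x y → position (ι₂ x) < position (ι₃ y)
  ι₂<ι₃ x y = <-≤-trans (ι₂<m₂ x) (m₂≤ι₃ y)

  position<bound : ∀ z → position z < m₂ + bound L₃
  position<bound (ι₁ x) = <-≤-trans (ι₁<m₁ x) (≤-trans m₁≤m₂ (m≤m+n m₂ (bound L₃)))
  position<bound (ι₂ x) = <-≤-trans (ι₂<m₂ x) (m≤m+n m₂ (bound L₃))
  position<bound (ι₃ x) = +-monoʳ-< m₂ (pos<bound L₃ x)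

  position-injective : ∀ {z z′} → Alive z → Alive z′ → position z ≡ position z′ → z ≡ z′
  position-injective {ι₁ x} {ι₁ y} _  _  eq = cong ι₁ (pos-injective L₁ tt tt eq)
  position-injective {ι₂ x} {ι₂ y} ax ay eq =
    cong ι₂ (pos-injective L₂ (ax ∘ cong ι₂) (ay ∘ cong ι₂) (+-cancelˡ-≡ m₁ _ _ eq))
  position-injective {ι₃ x} {ι₃ y} _  _  eq = cong ι₃ (pos-injective L₃ tt tt (+-cancelˡ-≡ m₂ _ _ eq))
  position-injective {ι₁ x} {ι₂ y} _  _  eq = contradiction eq (<⇒≢ (ι₁<ι₂ x y))
  position-injective {ι₁ x} {ι₃ y} _  _  eq = contradiction eq (<⇒≢ (ι₁<ι₃ x y))
  position-injective {ι₂ x} {ι₃ y} _  _  eq = contradiction eq (<⇒≢ (ι₂<ι₃ x y))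
  position-injective {ι₂ x} {ι₁ y} _  _  eq = contradiction (sym eq) (<⇒≢ (ι₁<ι₂ y x))
  position-injective {ι₃ x} {ι₁ y} _  _  eq = contradiction (sym eq) (<⇒≢ (ι₁<ι₃ y x))
  position-injective {ι₃ x} {ι₂ y} _  _  eq = contradiction (sym eq) (<⇒≢ (ι₂<ι₃ y x))

  first-block : ∀ {t} → t < pos L₁ v₁ → Spanned A (Row t) (Col t) (suc k)
  first-block {t} t<v₁ = record { basis = basis′ ; coeff = coeff′ ; spans = spans′ }
    where
    open Spanned (prefix-spanned L₁ t)
    basis′ : Fin (suc k) → V → Bool
    basis′ j (ι₁ y) = basis j y
    basis′ j _      = false
    coeff′ : V → Fin (suc k) → Bool
    coeff′ (ι₁ x) = coeff x
    coeff′ _      = λ _ → false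
    t<m₁ : t < m₁
    t<m₁ = <-trans t<v₁ (ι₁<m₁ v₁)
    off-triangle : ∀ {x} → pos L₁ x ≤ t → ⌊ x ≟ v₁ ⌋ ≡ false
    off-triangle x≤t = ⌊≟⌋-≢ λ { refl → <⇒≱ t<v₁ x≤t }
    spans′ : ∀ {z z′} → Row t z → Col t z′ → A z z′ ≡ combination (coeff′ z) basis′ z′
    spans′ {ι₁ x} {ι₁ y} (_ , x≤t) (_ , t<y) = spans (tt , x≤t) (tt , t<y)
    spans′ {ι₁ x} {ι₂ y} (_ , x≤t) _ =
      trans (cong (_∧ _) (off-triangle x≤t)) (sym (combination-zeroʳ (coeff x) basis′ (ι₂ y) λ _ → refl))
    spans′ {ι₁ x} {ι₃ y} (_ , x≤t) _ =
      trans (cong (_∧ _) (off-triangle x≤t)) (sym (combination-zeroʳ (coeff x) basis′ (ι₃ y) λ _ → refl))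
    spans′ {ι₂ x} x-row _ = ⊥-elim (∉Row (<-≤-trans t<m₁ (m₁≤ι₂ x)) x-row)
    spans′ {ι₃ x} x-row _ = ⊥-elim (∉Row (<-≤-trans t<m₁ (m₁≤ι₃ x)) x-row)

  junction : ∀ {t} → pos L₁ v₁ ≤ t → t < m₁ → Spanned A (Row t) (Col t) (suc k)
  junction {t} v₁≤t t<m₁ = record { basis = basis′ ; coeff = coeff′ ; spans = spans′ }
    where
    basis′ : Fin (suc k) → V → Bool
    basis′ = triangle ∷ λ _ _ → false
    coeff′ : V → Fin (suc k) → Bool
    coeff′ z = triangle z ∷ λ _ → false
    spans′ : ∀ {z z′} → Row t z → Col t z′ → A z z′ ≡ combination (coeff′ z) basis′ z′
    spans′ {ι₁ x} {ι₁ y} _ y-col = ⊥-elim (∉Col (≤-trans (v₁-last y) v₁≤t) y-col)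
    spans′ {ι₁ x} {ι₂ y} _ _     = sym (xor-xorSum-false {k} (⌊ x ≟ v₁ ⌋ ∧ ⌊ y ≟ v₂ ⌋))
    spans′ {ι₁ x} {ι₃ y} _ _     = sym (xor-xorSum-false {k} (⌊ x ≟ v₁ ⌋ ∧ ⌊ y ≟ v₃ ⌋))
    spans′ {ι₂ x} x-row _ = ⊥-elim (∉Row (<-≤-trans t<m₁ (m₁≤ι₂ x)) x-row)
    spans′ {ι₃ x} x-row _ = ⊥-elim (∉Row (<-≤-trans t<m₁ (m₁≤ι₃ x)) x-row)

  -- Every edge between blocks lies on the triangle, so the first spanning vector `triangle`
  -- accounts for all of them; on edges inside G₂ it contributes nothing, because no vertex
  -- lies both in the prefix and in its complement.
  middle-block : ∀ {s} → s < bound L₂ → Spanned A (Row (m₁ + s)) (Col (m₁ + s)) (suc k)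
  middle-block {s} s<b₂ = record { basis = basis′ ; coeff = coeff′ ; spans = spans′ }
    where
    open Spanned (prefix-spanned L₂ s)
    t = m₁ + s
    basis′ : Fin (suc k) → V → Bool
    basis′ = triangle ∷ λ where
      j (ι₂ y) → basis j y
      j _      → false
    coeff′ : V → Fin (suc k) → Bool
    coeff′ (ι₁ x) = triangle (ι₁ x) ∷ λ _ → false
    coeff′ (ι₂ x) = triangle (ι₂ x) ∷ coeff x
    coeff′ (ι₃ x) = λ _ → false
    t<m₂ : t < m₂
    t<m₂ = +-monoʳ-< m₁ s<b₂
    spans′ : ∀ {z z′} → Row t z → Col t z′ → A z z′ ≡ combination (coeff′ z) basis′ z′
    spans′ {ι₁ x} {ι₁ y} _ y-col = ⊥-elim (∉Col (≤-trans (<⇒≤ (ι₁<m₁ y)) (m≤m+n m₁ s)) y-col)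
    spans′ {ι₁ x} {ι₂ y} _ _ = sym (xor-xorSum-false {k} (⌊ x ≟ v₁ ⌋ ∧ ⌊ y ≟ v₂ ⌋))
    spans′ {ι₁ x} {ι₃ y} _ _ = sym (xor-xorSum-false {k} (⌊ x ≟ v₁ ⌋ ∧ ⌊ y ≟ v₃ ⌋))
    spans′ {ι₂ x} {ι₁ y} _ y-col = ⊥-elim (∉Col (≤-trans (<⇒≤ (ι₁<m₁ y)) (m≤m+n m₁ s)) y-col)
    spans′ {ι₂ x} {ι₂ y} (x-alive , x≤t) (y-alive , t<y) =
      trans (spans (x-alive ∘ cong ι₂ , +-cancelˡ-≤ m₁ _ _ x≤t) (y-alive ∘ cong ι₂ , +-cancelˡ-< m₁ _ _ t<y))
            (cong (_xor combination (coeff x) basis y)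
                  (sym (distinct-not-both {x = x} {y} {v₂} λ { refl → <⇒≱ t<y x≤t })))
    spans′ {ι₂ x} {ι₃ y} _ _ =
      sym (trans (cong ((⌊ x ≟ v₂ ⌋ ∧ ⌊ y ≟ v₃ ⌋) xor_)
                            (combination-zeroʳ (coeff x) (λ j → basis′ (suc j)) (ι₃ y) λ _ → refl))
                 (xor-identityʳ _))
    spans′ {ι₃ x} x-row _ = ⊥-elim (∉Row (<-≤-trans t<m₂ (m₂≤ι₃ x)) x-row)

  last-block : ∀ s → Spanned A (Row (m₂ + s)) (Col (m₂ + s)) (suc k)
  last-block s = record { basis = basis′ ; coeff = coeff′ ; spans = spans′ }
    where
    open Spanned (prefix-spanned L₃ s)
    t = m₂ + s
    basis′ : Fin (suc k) → V → Bool
    basis′ j (ι₃ y) = basis j y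
    basis′ j _      = false
    coeff′ : V → Fin (suc k) → Bool
    coeff′ (ι₃ x) = coeff x
    coeff′ _      = λ _ → false
    off-triangle : ∀ {y} → s < pos L₃ y → ⌊ y ≟ v₃ ⌋ ≡ false
    off-triangle s<y = ⌊≟⌋-≢ λ { refl → <⇒≱ s<y (subst (_≤ s) (sym v₃-first) z≤n) }
    spans′ : ∀ {z z′} → Row t z → Col t z′ → A z z′ ≡ combination (coeff′ z) basis′ z′
    spans′ {_} {ι₁ y} _ y-col =
      ⊥-elim (∉Col (≤-trans (<⇒≤ (ι₁<m₁ y)) (≤-trans m₁≤m₂ (m≤m+n m₂ s))) y-col)
    spans′ {_} {ι₂ y} _ y-col = ⊥-elim (∉Col (≤-trans (<⇒≤ (ι₂<m₂ y)) (m≤m+n m₂ s)) y-col)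
    spans′ {ι₁ x} {ι₃ y} _ (_ , t<y) =
      trans (cong (⌊ x ≟ v₁ ⌋ ∧_) (off-triangle (+-cancelˡ-< m₂ _ _ t<y)))
            (trans (∧-zeroʳ _) (sym (xorSum-false (suc k))))
    spans′ {ι₂ x} {ι₃ y} _ (_ , t<y) =
      trans (cong (⌊ x ≟ v₂ ⌋ ∧_) (off-triangle (+-cancelˡ-< m₂ _ _ t<y)))
            (trans (∧-zeroʳ _) (sym (xorSum-false (suc k))))
    spans′ {ι₃ x} {ι₃ y} (_ , x≤t) (_ , t<y) = spans (tt , +-cancelˡ-≤ m₂ _ _ x≤t) (tt , +-cancelˡ-< m₂ _ _ t<y)

  cut-spanned : ∀ t → Spanned A (Row t) (Col t) (suc k)
  cut-spanned t with t <? pos L₁ v₁ | t <? m₁ | t <? m₂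
  ... | yes t<v₁ | _        | _        = first-block t<v₁
  ... | no  t≮v₁ | yes t<m₁ | _        = junction (≮⇒≥ t≮v₁) t<m₁
  ... | no  _    | no  t≮m₁ | yes t<m₂ with s , refl ← m≤n⇒∃[o]m+o≡n (≮⇒≥ t≮m₁) =
    middle-block (+-cancelˡ-< m₁ s _ t<m₂)
  ... | no  _    | no  _    | no  t≮m₂ with s , refl ← m≤n⇒∃[o]m+o≡n (≮⇒≥ t≮m₂) = last-block s

  deltaLayout : Layout A Alive (suc k)
  deltaLayout = record
    { pos            = position
    ; bound          = m₂ + bound L₃
    ; pos<bound      = position<bound
    ; pos-injective  = position-injective
    ; prefix-spanned = cut-spanned
    }

swap₁₂ : ∀ {A B C : Set} → A ⊎ (B ⊎ C) → B ⊎ (A ⊎ C)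
swap₁₂ (ι₁ x) = ι₂ x
swap₁₂ (ι₂ x) = ι₁ x
swap₁₂ (ι₃ x) = ι₃ x

swap₁₂-involutive : ∀ {A B C : Set} (p : A ⊎ (B ⊎ C)) → swap₁₂ (swap₁₂ p) ≡ p
swap₁₂-involutive (ι₁ x) = refl
swap₁₂-involutive (ι₂ x) = refl
swap₁₂-involutive (ι₃ x) = refl

swap₂₃ : ∀ {A B C : Set} → A ⊎ (B ⊎ C) → A ⊎ (C ⊎ B)
swap₂₃ (ι₁ x) = ι₁ x
swap₂₃ (ι₂ x) = ι₃ x
swap₂₃ (ι₃ x) = ι₂ x

swap₂₃-involutive : ∀ {A B C : Set} (p : A ⊎ (B ⊎ C)) → swap₂₃ (swap₂₃ p) ≡ p
swap₂₃-involutive (ι₁ x) = refl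
swap₂₃-involutive (ι₂ x) = refl
swap₂₃-involutive (ι₃ x) = refl

module _ {a b c} {G₁ : Graph a} {G₂ : Graph b} {G₃ : Graph c} {v₁ : Fin a} {v₂ : Fin b} {v₃ : Fin c} where

  adjP-swap₁₂ : ∀ p q → adjP G₁ G₂ G₃ v₁ v₂ v₃ p q ≡ adjP G₂ G₁ G₃ v₂ v₁ v₃ (swap₁₂ p) (swap₁₂ q)
  adjP-swap₁₂ (ι₁ x) (ι₁ y) = refl
  adjP-swap₁₂ (ι₁ x) (ι₂ y) = refl
  adjP-swap₁₂ (ι₁ x) (ι₃ y) = refl
  adjP-swap₁₂ (ι₂ x) (ι₁ y) = refl
  adjP-swap₁₂ (ι₂ x) (ι₂ y) = refl
  adjP-swap₁₂ (ι₂ x) (ι₃ y) = refl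
  adjP-swap₁₂ (ι₃ x) (ι₁ y) = refl
  adjP-swap₁₂ (ι₃ x) (ι₂ y) = refl
  adjP-swap₁₂ (ι₃ x) (ι₃ y) = refl

  adjP-swap₂₃ : ∀ p q → adjP G₁ G₂ G₃ v₁ v₂ v₃ p q ≡ adjP G₁ G₃ G₂ v₁ v₃ v₂ (swap₂₃ p) (swap₂₃ q)
  adjP-swap₂₃ (ι₁ x) (ι₁ y) = refl
  adjP-swap₂₃ (ι₁ x) (ι₂ y) = refl
  adjP-swap₂₃ (ι₁ x) (ι₃ y) = refl
  adjP-swap₂₃ (ι₂ x) (ι₁ y) = refl
  adjP-swap₂₃ (ι₂ x) (ι₂ y) = refl
  adjP-swap₂₃ (ι₂ x) (ι₃ y) = refl
  adjP-swap₂₃ (ι₃ x) (ι₁ y) = refl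
  adjP-swap₂₃ (ι₃ x) (ι₂ y) = refl
  adjP-swap₂₃ (ι₃ x) (ι₃ y) = refl

part-injective : ∀ {a b c} (G₁ : Graph a) (G₂ : Graph b) (G₃ : Graph c) v₁ v₂ v₃ →
                 Injective _≡_ _≡_ (part G₁ G₂ G₃ v₁ v₂ v₃)
part-injective {a} {b} {c} G₁ G₂ G₃ v₁ v₂ v₃ = strictlyInverseʳ⇒injective unpart unpart-part
  where
  unpart : Part G₁ G₂ G₃ v₁ v₂ v₃ → Fin (a + (b + c))
  unpart (ι₁ x) = join a (b + c) (inj₁ x)
  unpart (ι₂ x) = join a (b + c) (inj₂ (join b c (inj₁ x)))
  unpart (ι₃ x) = join a (b + c) (inj₂ (join b c (inj₂ x)))
  splitAt⁻¹ : ∀ m {n} {x : Fin (m + n)} {s} → splitAt m x ≡ s → join m n s ≡ x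
  splitAt⁻¹ m {n} {x} eq = trans (cong (join m n) (sym eq)) (join-splitAt m n x)
  unpart-part : ∀ x → unpart (part G₁ G₂ G₃ v₁ v₂ v₃ x) ≡ x
  unpart-part x with splitAt a x in eq
  ... | inj₁ y = splitAt⁻¹ a eq
  ... | inj₂ z with splitAt b z in eq′
  ...   | inj₁ y = trans (cong (join a (b + c) ∘ inj₂) (splitAt⁻¹ b eq′)) (splitAt⁻¹ a eq)
  ...   | inj₂ y = trans (cong (join a (b + c) ∘ inj₂) (splitAt⁻¹ b eq′)) (splitAt⁻¹ a eq)

deltaComp-layout-middle : ∀ {a b c k} {G₁ : Graph a} {G₂ : Graph b} {G₃ : Graph c} {v₁ v₂ v₃ u} →
  Layout (adj G₁) (_≢ v₁) k → Layout (adj G₂) (_≢ u) k → Layout (adj G₃) (_≢ v₃) k →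
  Layout (adjP G₁ G₂ G₃ v₁ v₂ v₃) (_≢ ι₂ u) (suc k)
deltaComp-layout-middle L₁ L₂ L₃ =
  DeltaLayout.deltaLayout (appendVertex L₁) (appendVertex-last L₁) L₂ (prependVertex L₃) (prependVertex-first L₃)

deltaComp-layout : ∀ {a b c k} {G₁ : Graph a} {G₂ : Graph b} {G₃ : Graph c} {v₁ v₂ v₃} →
  (∀ v → Layout (adj G₁) (_≢ v) k) → (∀ v → Layout (adj G₂) (_≢ v) k) → (∀ v → Layout (adj G₃) (_≢ v) k) →
  ∀ p → Layout (adjP G₁ G₂ G₃ v₁ v₂ v₃) (_≢ p) (suc k)
deltaComp-layout {v₁ = v₁} {v₂} {v₃} L₁ L₂ L₃ (ι₁ u) =
  Layout-pullback-≢ swap₁₂ adjP-swap₁₂ (strictlyInverseʳ⇒injective swap₁₂ swap₁₂-involutive)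
    (deltaComp-layout-middle (L₂ v₂) (L₁ u) (L₃ v₃))
deltaComp-layout {v₁ = v₁} {v₂} {v₃} L₁ L₂ L₃ (ι₂ u) = deltaComp-layout-middle (L₁ v₁) (L₂ u) (L₃ v₃)
deltaComp-layout {v₁ = v₁} {v₂} {v₃} L₁ L₂ L₃ (ι₃ u) =
  Layout-pullback-≢ swap₂₃ adjP-swap₂₃ (strictlyInverseʳ⇒injective swap₂₃ swap₂₃-involutive)
    (deltaComp-layout-middle (L₁ v₁) (L₃ u) (L₂ v₂))

Δ⇒layout : ∀ {k n} {G : Graph n} → Δ k G → ∀ v → Layout (adj G) (_≢ v) k
Δ⇒layout (base (π , π-adj)) v =
  Layout-pullback-≢ (π ⟨$⟩ʳ_) π-adj (⟨$⟩ʳ-injective π) (K2-layout (π ⟨$⟩ʳ v))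
Δ⇒layout (comp {G₁ = G₁} {G₂} {G₃} Δ₁ Δ₂ Δ₃ v₁ v₂ v₃ (π , π-adj)) v =
  Layout-pullback-≢ (parts ∘ (π ⟨$⟩ʳ_)) π-adj (⟨$⟩ʳ-injective π ∘ part-injective G₁ G₂ G₃ v₁ v₂ v₃)
    (deltaComp-layout (Δ⇒layout Δ₁) (Δ⇒layout Δ₂) (Δ⇒layout Δ₃) (parts (π ⟨$⟩ʳ v)))
  where parts = part G₁ G₂ G₃ v₁ v₂ v₃

Layout-∖ : ∀ {n k} (G : Graph (suc n)) v → Layout (adj G) (_≢ v) k → Layout (adj (G ∖ v)) (λ _ → ⊤) k
Layout-∖ G v = Layout-pullback (punchIn v) (λ _ _ → refl) (λ _ → punchInᵢ≢i v _) (punchIn-injective v _ _)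

lemma3p9 : (k n : ℕ) (G : Graph (suc n)) → Δ k G →
           (v : Fin (suc n)) → LinRankWidthAtMost (G ∖ v) k
lemma3p9 k n G G∈Δₖ v = layout⇒linRankWidthAtMost (G ∖ v) (Layout-∖ G v (Δ⇒layout G∈Δₖ v))
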